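{- For every pair of positive integers $a,b$ and every integer $k$ with $1\le k\le\min(a,b)$, there exist positions $\sigma$ and $\sigma'$ of the parallel chip-firing game on the complete bipartite graph $K_{a,b}$ with $p(\sigma)=k$ and $p(\sigma')=2k$.
   Context: Parallel chip-firing game: a position $\sigma$ assigns a nonnegative integer to each vertex; at each step every vertex $v$ with at least $\deg(v)$ chips simultaneously sends one chip to each neighbor. $U$ is the step operator. The period $p(\sigma)$ is the least positive integer $p$ with $U^t\sigma=U^{t+p}\sigma$ for all sufficiently large $t$. -}

module Defs where

open import Data.Nat using (ℕ; zero; suc; _+_; _∸_; _≤_; _<_; _≤ᵇ_; _<ᵇ_)
open import Data.Fin using (Fin; zero; suc; toℕ)
open import Data.Bool using (Bool; true; false; if_then_else_; _∧_; _xor_)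
open import Data.Product using (∃; _×_)
open import Relation.Nullary using (¬_)
open import Relation.Binary.PropositionalEquality using (_≡_)

-- A simple graph on vertex set Fin n, given by a (symmetric, loopless) Boolean adjacency.
Graph : ℕ → Set
Graph n = Fin n → Fin n → Bool

sumFin : (n : ℕ) → (Fin n → ℕ) → ℕ
sumFin zero    f = 0
sumFin (suc n) f = f zero + sumFin n (λ i → f (suc i))

Position : ℕ → Set
Position n = Fin n → ℕ

deg : ∀ {n} → Graph n → Fin n → ℕ
deg {n} G v = sumFin n (λ u → if G u v then 1 else 0)

fires : ∀ {n} → Graph n → Position n → Fin n → Bool
fires G σ v = deg G v ≤ᵇ σ v

U : ∀ {n} → Graph n → Position n → Position n
U {n} G σ v =
  (σ v ∸ (if fires G σ v then deg G v else 0))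
  + sumFin n (λ u → if G u v ∧ fires G σ u then 1 else 0)

iterU : ∀ {n} → Graph n → ℕ → Position n → Position n
iterU G zero    σ = σ
iterU G (suc t) σ = U G (iterU G t σ)

IsEventualPeriod : ∀ {n} → Graph n → Position n → ℕ → Set
IsEventualPeriod G σ p =
  ∃ λ t₀ → ∀ t → t₀ ≤ t → ∀ v → iterU G t σ v ≡ iterU G (t + p) σ v

-- p(σ) = p : p is the least positive eventual period.
HasPeriod : ∀ {n} → Graph n → Position n → ℕ → Set
HasPeriod G σ p =
  (0 < p) × IsEventualPeriod G σ p × (∀ q → 0 < q → q < p → ¬ IsEventualPeriod G σ q)

-- Complete bipartite graph K_{a,b} on Fin (a + b): vertices with index < a form
-- one side, the remaining b vertices the other side.
K : (a b : ℕ) → Graph (a + b)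
K a b u v = (toℕ u <ᵇ a) xor (toℕ v <ᵇ a)

module Submission where

-- Fix a period P and give every vertex a phase in [0,P), the moment at which
-- it is to fire.  If S φ counts the neighbours of phase below φ, a vertex of
-- degree d and phase c carries  d ∸ (S c ∸ S φ)  chips at phase φ ≤ c and
-- S φ ∸ S c  at φ > c.  If no vertex reaches its degree before its phase (H1)
-- and none refills before the period ends (H2), every vertex fires exactly at
-- its phase, so U maps the position of phase φ to that of phase φ + 1 mod P.
-- The phase-0 position thus cycles with period P, which is least because a
-- vertex of phase 0 holds its degree only at phase 0.

open import Defs
open import Data.Nat
  using (ℕ; zero; suc; _+_; _*_; _∸_; _≤_; _<_; _≤ᵇ_; _<ᵇ_; _≡ᵇ_; z≤n; s≤s; z<s; s<s; _⊓_; _<?_;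
         NonZero; >-nonZero⁻¹)
open import Data.Nat.Properties
open import Data.Nat.DivMod
  using (_%_; _/_; m≡m%n+[m/n]*n; [m+kn]%n≡m%n; [m+n]%n≡m%n; m*n%n≡0; m%n<n; m<n⇒m%n≡m; n%n≡0)
open import Algebra.Properties.CommutativeSemigroup +-commutativeSemigroup using (interchange)
open import Data.Fin using (Fin; zero; suc; toℕ; fromℕ<)
open import Data.Fin.Properties using (toℕ-fromℕ<; toℕ<n)
open import Data.Bool using (Bool; true; false; T; if_then_else_; _∧_; _xor_)
open import Data.Empty using (⊥-elim)
open import Data.Sum using (inj₁; inj₂)
open import Data.Product using (∃; _×_; _,_)
open import Relation.Nullary using (¬_; yes; no)
open import Relation.Binary.Definitions using (tri<; tri≈; tri>)
open import Relation.Binary.PropositionalEquality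

T⇒≡true : ∀ {b} → T b → b ≡ true
T⇒≡true {true} _ = refl

¬T⇒≡false : ∀ {b} → ¬ T b → b ≡ false
¬T⇒≡false {false} _ = refl
¬T⇒≡false {true} ¬t = ⊥-elim (¬t _)

<ᵇ-true : ∀ {m n} → m < n → (m <ᵇ n) ≡ true
<ᵇ-true m<n = T⇒≡true (<⇒<ᵇ m<n)

<ᵇ-false : ∀ {m n} → n ≤ m → (m <ᵇ n) ≡ false
<ᵇ-false {m} {n} n≤m = ¬T⇒≡false (λ m<ᵇn → <⇒≱ (<ᵇ⇒< m n m<ᵇn) n≤m)

≤ᵇ-true : ∀ {m n} → m ≤ n → (m ≤ᵇ n) ≡ true
≤ᵇ-true m≤n = T⇒≡true (≤⇒≤ᵇ m≤n)

≤ᵇ-false : ∀ {m n} → n < m → (m ≤ᵇ n) ≡ false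
≤ᵇ-false {m} {n} n<m = ¬T⇒≡false (λ m≤ᵇn → <⇒≱ n<m (≤ᵇ⇒≤ m n m≤ᵇn))

≡ᵇ-true : ∀ {m n} → m ≡ n → (m ≡ᵇ n) ≡ true
≡ᵇ-true {m} {n} m≡n = T⇒≡true (≡⇒≡ᵇ m n m≡n)

≡ᵇ-false : ∀ {m n} → ¬ m ≡ n → (m ≡ᵇ n) ≡ false
≡ᵇ-false {m} {n} m≢n = ¬T⇒≡false (λ m≡ᵇn → m≢n (≡ᵇ⇒≡ m n m≡ᵇn))

-- Finite sums Σ_{i<n} g i over natural-number indices, expressed through the
-- sum over Fin n used by the game (so that the two agree definitionally).

sumBelow : ℕ → (ℕ → ℕ) → ℕ
sumBelow n g = sumFin n (λ i → g (toℕ i))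

sumFin-cong : ∀ n {f g : Fin n → ℕ} → (∀ u → f u ≡ g u) → sumFin n f ≡ sumFin n g
sumFin-cong zero f≗g = refl
sumFin-cong (suc n) f≗g = cong₂ _+_ (f≗g zero) (sumFin-cong n (λ u → f≗g (suc u)))

sumBelow-cong : ∀ n {f g : ℕ → ℕ} → (∀ i → i < n → f i ≡ g i) → sumBelow n f ≡ sumBelow n g
sumBelow-cong zero f≗g = refl
sumBelow-cong (suc n) {f} {g} f≗g =
  cong₂ _+_ (f≗g 0 z<s) (sumBelow-cong n {λ i → f (suc i)} {λ i → g (suc i)} (λ i i<n → f≗g (suc i) (s<s i<n)))

sumBelow-split : ∀ a b g → sumBelow (a + b) g ≡ sumBelow a g + sumBelow b (λ j → g (a + j))
sumBelow-split zero b g = refl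
sumBelow-split (suc a) b g =
  trans (cong (g 0 +_) (sumBelow-split a b (λ i → g (suc i)))) (sym (+-assoc (g 0) _ _))

sumBelow-const : ∀ n c → sumBelow n (λ _ → c) ≡ n * c
sumBelow-const zero c = refl
sumBelow-const (suc n) c = cong (c +_) (sumBelow-const n c)

sumBelow-+ : ∀ n f g → sumBelow n (λ i → f i + g i) ≡ sumBelow n f + sumBelow n g
sumBelow-+ zero f g = refl
sumBelow-+ (suc n) f g =
  trans (cong (f 0 + g 0 +_) (sumBelow-+ n (λ i → f (suc i)) (λ i → g (suc i))))
        (interchange (f 0) (g 0) _ _)

sumBelow-mono : ∀ n {f g : ℕ → ℕ} → (∀ i → i < n → f i ≤ g i) → sumBelow n f ≤ sumBelow n g
sumBelow-mono zero f≤g = z≤n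
sumBelow-mono (suc n) {f} {g} f≤g =
  +-mono-≤ (f≤g 0 z<s) (sumBelow-mono n {λ i → f (suc i)} {λ i → g (suc i)} (λ i i<n → f≤g (suc i) (s<s i<n)))

sumBelow-strict : ∀ n {f g : ℕ → ℕ} → (∀ i → i < n → f i ≤ g i) →
  ∀ j → j < n → f j < g j → sumBelow n f < sumBelow n g
sumBelow-strict (suc n) {f} {g} f≤g zero _ f0<g0 =
  +-mono-<-≤ f0<g0 (sumBelow-mono n {λ i → f (suc i)} {λ i → g (suc i)} (λ i i<n → f≤g (suc i) (s<s i<n)))
sumBelow-strict (suc n) {f} {g} f≤g (suc j) (s<s j<n) fj<gj =
  +-mono-≤-< (f≤g 0 z<s)
    (sumBelow-strict n {λ i → f (suc i)} {λ i → g (suc i)} (λ i i<n → f≤g (suc i) (s<s i<n)) j j<n fj<gj)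

-- Counting: the number of i < n satisfying a Boolean predicate, as a sum of
-- indicators (the game counts firing neighbours the same way).

ind : Bool → ℕ
ind b = if b then 1 else 0

count : ℕ → (ℕ → Bool) → ℕ
count n p = sumBelow n (λ i → ind (p i))

count-cong : ∀ n {p q : ℕ → Bool} → (∀ i → i < n → p i ≡ q i) → count n p ≡ count n q
count-cong n p≗q = sumBelow-cong n (λ i i<n → cong ind (p≗q i i<n))

sumBelow-zeros : ∀ n → sumBelow n (λ _ → 0) ≡ 0
sumBelow-zeros n = trans (sumBelow-const n 0) (*-zeroʳ n)

sumBelow-ones : ∀ n → sumBelow n (λ _ → 1) ≡ n
sumBelow-ones n = trans (sumBelow-const n 1) (*-identityʳ n)

count-≤ : ∀ n p → count n p ≤ n
count-≤ n p = subst (count n p ≤_) (sumBelow-ones n) (sumBelow-mono n (λ i _ → ind≤1 (p i)))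
  where
  ind≤1 : ∀ b → ind b ≤ 1
  ind≤1 true = ≤-refl
  ind≤1 false = z≤n

-- Given phases f 0, …, f (n-1), 'before n f φ' is the number of them below φ:
-- how many of n neighbours have fired during the phases 0, …, φ-1.

before : ℕ → (ℕ → ℕ) → ℕ → ℕ
before n f φ = count n (λ i → f i <ᵇ φ)

before-zero : ∀ n f → before n f 0 ≡ 0
before-zero n f = trans (count-cong n (λ i _ → <ᵇ-false {f i} z≤n)) (sumBelow-zeros n)

before-all : ∀ n f P → (∀ i → i < n → f i < P) → before n f P ≡ n
before-all n f P f<P = trans (count-cong n (λ i i<n → <ᵇ-true (f<P i i<n))) (sumBelow-ones n)

ind-<ᵇ-mono : ∀ x {φ ψ} → φ ≤ ψ → ind (x <ᵇ φ) ≤ ind (x <ᵇ ψ)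
ind-<ᵇ-mono x {φ} φ≤ψ with x <? φ
... | yes x<φ rewrite <ᵇ-true x<φ | <ᵇ-true (<-≤-trans x<φ φ≤ψ) = ≤-refl
... | no x≮φ rewrite <ᵇ-false (≮⇒≥ x≮φ) = z≤n

before-mono : ∀ n f {φ ψ} → φ ≤ ψ → before n f φ ≤ before n f ψ
before-mono n f φ≤ψ = sumBelow-mono n (λ i _ → ind-<ᵇ-mono (f i) φ≤ψ)

before-strict : ∀ n f {φ ψ} j → j < n → φ ≤ f j → f j < ψ → before n f φ < before n f ψ
before-strict n f {φ} {ψ} j j<n φ≤fj fj<ψ =
  sumBelow-strict n (λ i _ → ind-<ᵇ-mono (f i) (≤-trans φ≤fj (<⇒≤ fj<ψ))) j j<n jumps
  where
  jumps : ind (f j <ᵇ φ) < ind (f j <ᵇ ψ)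
  jumps rewrite <ᵇ-false {f j} φ≤fj | <ᵇ-true fj<ψ = ≤-refl

before-<-all : ∀ n f P → (∀ i → i < n → f i < P) → ∀ {φ} j → j < n → φ ≤ f j → before n f φ < n
before-<-all n f P f<P j j<n φ≤fj = subst (_ <_) (before-all n f P f<P) (before-strict n f j j<n φ≤fj (f<P j j<n))

before-suc : ∀ n f φ → before n f (suc φ) ∸ before n f φ ≡ count n (λ i → f i ≡ᵇ φ)
before-suc n f φ = begin
  before n f (suc φ) ∸ before n f φ
    ≡⟨ cong (_∸ before n f φ) split ⟩
  before n f φ + count n (λ i → f i ≡ᵇ φ) ∸ before n f φ
    ≡⟨ m+n∸m≡n (before n f φ) _ ⟩
  count n (λ i → f i ≡ᵇ φ) ∎
  where
  open ≡-Reasoning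
  ind-split : ∀ x φ → ind (x <ᵇ suc φ) ≡ ind (x <ᵇ φ) + ind (x ≡ᵇ φ)
  ind-split zero zero = refl
  ind-split zero (suc φ) = refl
  ind-split (suc x) zero = refl
  ind-split (suc x) (suc φ) = ind-split x φ
  split : before n f (suc φ) ≡ before n f φ + count n (λ i → f i ≡ᵇ φ)
  split = trans (sumBelow-cong n (λ i _ → ind-split (f i) φ))
                (sumBelow-+ n (λ i → ind (f i <ᵇ φ)) (λ i → ind (f i ≡ᵇ φ)))

telescope : ∀ {x y z} → x ≤ y → y ≤ z → (y ∸ x) + (z ∸ y) ≡ z ∸ x
telescope {x} {y} {z} x≤y y≤z = begin
  (y ∸ x) + (z ∸ y) ≡⟨ +-comm (y ∸ x) _ ⟩
  (z ∸ y) + (y ∸ x) ≡⟨ sym (+-∸-assoc (z ∸ y) x≤y) ⟩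
  (z ∸ y) + y ∸ x   ≡⟨ cong (_∸ x) (m∸n+n≡m y≤z) ⟩
  z ∸ x             ∎
  where open ≡-Reasoning

-- A vertex short of z ∸ x chips that receives y ∸ x more is short of z ∸ y.
refill : ∀ {x y z d} → x ≤ y → y ≤ z → z ≤ d → d ∸ (z ∸ x) + (y ∸ x) ≡ d ∸ (z ∸ y)
refill {x} {y} {z} {d} x≤y y≤z z≤d = begin
  d ∸ (z ∸ x) + (y ∸ x)               ≡⟨ cong (λ s → d ∸ s + (y ∸ x)) (sym z∸x) ⟩
  d ∸ ((z ∸ y) + (y ∸ x)) + (y ∸ x)   ≡⟨ cong (_+ (y ∸ x)) (sym (∸-+-assoc d (z ∸ y) (y ∸ x))) ⟩
  d ∸ (z ∸ y) ∸ (y ∸ x) + (y ∸ x)     ≡⟨ m∸n+n≡m (m+n≤o⇒m≤o∸n (y ∸ x) fits) ⟩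
  d ∸ (z ∸ y)                         ∎
  where
  open ≡-Reasoning
  z∸x : (z ∸ y) + (y ∸ x) ≡ z ∸ x
  z∸x = trans (+-comm (z ∸ y) _) (telescope x≤y y≤z)
  fits : (y ∸ x) + (z ∸ y) ≤ d
  fits = subst (_≤ d) (sym (telescope x≤y y≤z)) (≤-trans (m∸n≤m z x) z≤d)

∸-<-bound : ∀ {u y d} → u ≤ d → 0 < y → 0 < d → u ∸ y < d
∸-<-bound {zero} {suc y} _ _ 0<d = 0<d
∸-<-bound {suc u} {suc y} u<d _ _ = ≤-<-trans (m∸n≤m u y) u<d

afterFiring : ℕ → ℕ → ℕ
afterFiring d x = x ∸ (if d ≤ᵇ x then d else 0)

afterFiring-fire : ∀ d → afterFiring d d ≡ 0
afterFiring-fire d rewrite ≤ᵇ-true (≤-refl {d}) = n∸n≡0 d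

afterFiring-idle : ∀ {d x} → x < d → afterFiring d x ≡ x
afterFiring-idle x<d rewrite ≤ᵇ-false x<d = refl

-- The chips at phase φ of a vertex of degree d and phase c whose neighbours
-- fire S φ times during the phases below φ.
load : ℕ → (ℕ → ℕ) → ℕ → ℕ → ℕ
load d S c φ = if φ ≤ᵇ c then d ∸ (S c ∸ S φ) else S φ ∸ S c

-- One vertex of phase c < P with d neighbours of phases f 0, …, f (d-1) < P.
-- (H1) it stays below its degree before its phase; (H2) after firing it
-- collects fewer than d chips for the rest of the period.
module Vertex (P : ℕ) ⦃ _ : NonZero P ⦄ (d : ℕ) (f : ℕ → ℕ) (f<P : ∀ j → j < d → f j < P)
  (c : ℕ) (c<P : c < P)
  (H1 : ∀ φ → φ < c → before d f φ < before d f c)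
  (H2 : ∀ φ → c < φ → φ < P → before d f φ ∸ before d f c < d) where

  S : ℕ → ℕ
  S = before d f

  L : ℕ → ℕ
  L = load d S c

  S≤d : ∀ {φ} → φ ≤ P → S φ ≤ d
  S≤d {φ} φ≤P = subst (S φ ≤_) (before-all d f P f<P) (before-mono d f φ≤P)

  load-upto : ∀ {φ} → φ ≤ c → L φ ≡ d ∸ (S c ∸ S φ)
  load-upto φ≤c rewrite ≤ᵇ-true φ≤c = refl

  load-after : ∀ {φ} → c < φ → L φ ≡ S φ ∸ S c
  load-after c<φ rewrite ≤ᵇ-false c<φ = refl

  load-at-phase : L c ≡ d
  load-at-phase = trans (load-upto ≤-refl) (cong (d ∸_) (n∸n≡0 (S c)))

  load-below-before : ∀ {φ} → φ < c → L φ < d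
  load-below-before {φ} φ<c rewrite load-upto (<⇒≤ φ<c) =
    ∸-monoʳ-< (m<n⇒0<n∸m (H1 φ φ<c)) (≤-trans (m∸n≤m (S c) (S φ)) (S≤d (<⇒≤ c<P)))

  load-below-after : ∀ {φ} → c < φ → φ < P → L φ < d
  load-below-after {φ} c<φ φ<P rewrite load-after c<φ = H2 φ c<φ φ<P

  load-wrap : L P ≡ L 0
  load-wrap = begin
    L P             ≡⟨ load-after c<P ⟩
    S P ∸ S c       ≡⟨ cong (_∸ S c) (before-all d f P f<P) ⟩
    d ∸ S c         ≡⟨ cong (λ s → d ∸ (S c ∸ s)) (sym (before-zero d f)) ⟩
    d ∸ (S c ∸ S 0) ≡⟨ sym (load-upto z≤n) ⟩
    L 0             ∎
    where open ≡-Reasoning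

  load-mod : ∀ {φ} → φ ≤ P → L (φ % P) ≡ L φ
  load-mod φ≤P with m<1+n⇒m<n∨m≡n (s≤s φ≤P)
  ... | inj₁ φ<P = cong L (m<n⇒m%n≡m φ<P)
  ... | inj₂ refl = trans (cong L (n%n≡0 P)) (sym load-wrap)

  fires-iff : ∀ φ → φ < P → (d ≤ᵇ L φ) ≡ (c ≡ᵇ φ)
  fires-iff φ φ<P with <-cmp c φ
  ... | tri≈ _ refl _ rewrite load-at-phase | ≡ᵇ-true (refl {x = c}) = ≤ᵇ-true (≤-refl {d})
  ... | tri< c<φ c≢φ _ rewrite ≡ᵇ-false c≢φ = ≤ᵇ-false (load-below-after c<φ φ<P)
  ... | tri> _ c≢φ φ<c rewrite ≡ᵇ-false c≢φ = ≤ᵇ-false (load-below-before φ<c)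

  step-within : ∀ φ → φ < P → afterFiring d (L φ) + (S (suc φ) ∸ S φ) ≡ L (suc φ)
  step-within φ φ<P with <-cmp c φ
  ... | tri≈ _ refl _ = begin
    afterFiring d (L c) + (S (suc c) ∸ S c) ≡⟨ cong (λ x → afterFiring d x + (S (suc c) ∸ S c)) load-at-phase ⟩
    afterFiring d d + (S (suc c) ∸ S c)     ≡⟨ cong (_+ (S (suc c) ∸ S c)) (afterFiring-fire d) ⟩
    S (suc c) ∸ S c                         ≡⟨ sym (load-after (n<1+n c)) ⟩
    L (suc c)                               ∎
    where open ≡-Reasoning
  ... | tri< c<φ _ _ = begin
    afterFiring d (L φ) + (S (suc φ) ∸ S φ) ≡⟨ cong (_+ (S (suc φ) ∸ S φ)) (afterFiring-idle (load-below-after c<φ φ<P)) ⟩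
    L φ + (S (suc φ) ∸ S φ)                 ≡⟨ cong (_+ (S (suc φ) ∸ S φ)) (load-after c<φ) ⟩
    (S φ ∸ S c) + (S (suc φ) ∸ S φ)         ≡⟨ telescope (before-mono d f (<⇒≤ c<φ)) (before-mono d f (n≤1+n φ)) ⟩
    S (suc φ) ∸ S c                         ≡⟨ sym (load-after (m<n⇒m<1+n c<φ)) ⟩
    L (suc φ)                               ∎
    where open ≡-Reasoning
  ... | tri> _ _ φ<c = begin
    afterFiring d (L φ) + (S (suc φ) ∸ S φ) ≡⟨ cong (_+ (S (suc φ) ∸ S φ)) (afterFiring-idle (load-below-before φ<c)) ⟩
    L φ + (S (suc φ) ∸ S φ)                 ≡⟨ cong (_+ (S (suc φ) ∸ S φ)) (load-upto (<⇒≤ φ<c)) ⟩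
    d ∸ (S c ∸ S φ) + (S (suc φ) ∸ S φ)     ≡⟨ refill (before-mono d f (n≤1+n φ)) (before-mono d f φ<c) (S≤d (<⇒≤ c<P)) ⟩
    d ∸ (S c ∸ S (suc φ))                   ≡⟨ sym (load-upto φ<c) ⟩
    L (suc φ)                               ∎
    where open ≡-Reasoning

  step : ∀ φ → φ < P → afterFiring d (L φ) + (S (suc φ) ∸ S φ) ≡ L (suc φ % P)
  step φ φ<P = trans (step-within φ φ<P) (sym (load-mod {suc φ} φ<P))

-- In K_{a,b} the left side is {0, …, a-1} and the right side {a, …, a+b-1};
-- summing over the neighbours of a vertex on side X (true: left) means
-- summing over the other side.
neighbourSum : ∀ a b X (F : ℕ → ℕ) →
  sumBelow (a + b) (λ y → if (y <ᵇ a) xor X then F y else 0)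
    ≡ (if X then sumBelow b (λ j → F (a + j)) else sumBelow a F)
neighbourSum a b X F = begin
  sumBelow (a + b) (λ y → if (y <ᵇ a) xor X then F y else 0)
    ≡⟨ sumBelow-split a b (λ y → if (y <ᵇ a) xor X then F y else 0) ⟩
  sumBelow a (λ i → if (i <ᵇ a) xor X then F i else 0)
    + sumBelow b (λ j → if (a + j <ᵇ a) xor X then F (a + j) else 0)
    ≡⟨ cong₂ _+_ (sumBelow-cong a (λ i i<a → cong (λ s → if s xor X then F i else 0) (<ᵇ-true i<a)))
                 (sumBelow-cong b (λ j _ → cong (λ s → if s xor X then F (a + j) else 0) (<ᵇ-false (m≤m+n a j)))) ⟩
  sumBelow a (λ i → if true xor X then F i else 0) + sumBelow b (λ j → if X then F (a + j) else 0)
    ≡⟨ bySide X ⟩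
  (if X then sumBelow b (λ j → F (a + j)) else sumBelow a F) ∎
  where
  open ≡-Reasoning
  bySide : ∀ X → sumBelow a (λ i → if true xor X then F i else 0) + sumBelow b (λ j → if X then F (a + j) else 0)
                   ≡ (if X then sumBelow b (λ j → F (a + j)) else sumBelow a F)
  bySide true = cong (_+ sumBelow b (λ j → F (a + j))) (sumBelow-zeros a)
  bySide false = trans (cong (sumBelow a F +_) (sumBelow-zeros b)) (+-identityʳ _)

deg-K : ∀ a b (v : Fin (a + b)) → deg (K a b) v ≡ (if toℕ v <ᵇ a then b else a)
deg-K a b v = trans (neighbourSum a b (toℕ v <ᵇ a) (λ _ → 1)) (bySide (toℕ v <ᵇ a))
  where
  bySide : ∀ X → (if X then sumBelow b (λ _ → 1) else sumBelow a (λ _ → 1)) ≡ (if X then b else a)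
  bySide true = sumBelow-ones b
  bySide false = sumBelow-ones a

data SideOf (a b : ℕ) : ℕ → Set where
  left  : ∀ {i} → i < a → SideOf a b i
  right : ∀ {j} → j < b → SideOf a b (a + j)

sideOf : ∀ a b {x} → x < a + b → SideOf a b x
sideOf a b {x} x<a+b with x <? a
... | yes x<a = left x<a
... | no x≮a = subst (SideOf a b) a+[x∸a]≡x (right (+-cancelˡ-< a (x ∸ a) b (subst (_< a + b) (sym a+[x∸a]≡x) x<a+b)))
  where
  a+[x∸a]≡x : a + (x ∸ a) ≡ x
  a+[x∸a]≡x = m+[n∸m]≡n (≮⇒≥ x≮a)

U-cong : ∀ {n} (G : Graph n) {σ τ : Position n} → (∀ v → σ v ≡ τ v) → ∀ v → U G σ v ≡ U G τ v
U-cong {n} G σ≗τ v = cong₂ _+_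
  (cong (afterFiring (deg G v)) (σ≗τ v))
  (sumFin-cong n (λ u → cong (λ x → if G u v ∧ (deg G u ≤ᵇ x) then 1 else 0) (σ≗τ u)))

suc-mod : ∀ t P ⦃ _ : NonZero P ⦄ → suc t % P ≡ suc (t % P) % P
suc-mod t P = trans (cong (λ m → suc m % P) (m≡m%n+[m/n]*n t P)) ([m+kn]%n≡m%n (suc (t % P)) (t / P) P)

orbit : ∀ {n} (G : Graph n) P ⦃ _ : NonZero P ⦄ (σ : ℕ → Position n) →
  (∀ φ → φ < P → ∀ v → U G (σ φ) v ≡ σ (suc φ % P) v) →
  ∀ t v → iterU G t (σ 0) v ≡ σ (t % P) v
orbit G P σ step zero v = cong (λ φ → σ φ v) (sym (m*n%n≡0 0 P))
orbit G P σ step (suc t) v = begin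
  U G (iterU G t (σ 0)) v ≡⟨ U-cong G (orbit G P σ step t) v ⟩
  U G (σ (t % P)) v       ≡⟨ step (t % P) (m%n<n t P) v ⟩
  σ (suc (t % P) % P) v   ≡⟨ cong (λ φ → σ φ v) (sym (suc-mod t P)) ⟩
  σ (suc t % P) v         ∎
  where open ≡-Reasoning

-- A cycle σ 0, …, σ (P-1) of positions in which σ 0 differs from every later
-- σ q gives σ 0 the exact period P: a smaller eventual period q would force
-- σ 0 = σ q, comparing the times t₀·P and t₀·P + q.
cycle-period : ∀ {n} (G : Graph n) P ⦃ _ : NonZero P ⦄ (σ : ℕ → Position n) →
  (∀ t v → iterU G t (σ 0) v ≡ σ (t % P) v) →
  (∀ q → 0 < q → q < P → ∃ λ v → ¬ σ 0 v ≡ σ q v) →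
  HasPeriod G (σ 0) P
cycle-period G P σ orbitσ distinct = >-nonZero⁻¹ P , isPeriod , notPeriod
  where
  isPeriod : IsEventualPeriod G (σ 0) P
  isPeriod = 0 , λ t _ v → begin
    iterU G t (σ 0) v       ≡⟨ orbitσ t v ⟩
    σ (t % P) v             ≡⟨ cong (λ φ → σ φ v) (sym ([m+n]%n≡m%n t P)) ⟩
    σ ((t + P) % P) v       ≡⟨ sym (orbitσ (t + P) v) ⟩
    iterU G (t + P) (σ 0) v ∎
    where open ≡-Reasoning

  notPeriod : ∀ q → 0 < q → q < P → ¬ IsEventualPeriod G (σ 0) q
  notPeriod q 0<q q<P (t₀ , periodic) with distinct q 0<q q<P
  ... | v , σ0≢σq = σ0≢σq (begin
    σ 0 v                     ≡⟨ cong (λ φ → σ φ v) (sym (m*n%n≡0 t₀ P)) ⟩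
    σ (t₀ * P % P) v          ≡⟨ sym (orbitσ (t₀ * P) v) ⟩
    iterU G (t₀ * P) (σ 0) v     ≡⟨ periodic (t₀ * P) (m≤m*n t₀ P) v ⟩
    iterU G (t₀ * P + q) (σ 0) v ≡⟨ orbitσ (t₀ * P + q) v ⟩
    σ ((t₀ * P + q) % P) v    ≡⟨ cong (λ φ → σ φ v) shift ⟩
    σ q v                     ∎)
    where
    open ≡-Reasoning
    shift : (t₀ * P + q) % P ≡ q
    shift = trans (cong (_% P) (+-comm (t₀ * P) q)) (trans ([m+kn]%n≡m%n q t₀ P) (m<n⇒m%n≡m q<P))

module PhasePosition (a b P : ℕ) ⦃ _ : NonZero P ⦄ (phL phR : ℕ → ℕ)
  (phL<P : ∀ i → i < a → phL i < P) (phR<P : ∀ j → j < b → phR j < P)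
  (H1L : ∀ i → i < a → ∀ φ → φ < phL i → before b phR φ < before b phR (phL i))
  (H2L : ∀ i → i < a → ∀ φ → phL i < φ → φ < P → before b phR φ ∸ before b phR (phL i) < b)
  (H1R : ∀ j → j < b → ∀ φ → φ < phR j → before a phL φ < before a phL (phR j))
  (H2R : ∀ j → j < b → ∀ φ → phR j < φ → φ < P → before a phL φ ∸ before a phL (phR j) < a) where

  module Left {i} (i<a : i < a) = Vertex P b phR phR<P (phL i) (phL<P i i<a) (H1L i i<a) (H2L i i<a)
  module Right {j} (j<b : j < b) = Vertex P a phL phL<P (phR j) (phR<P j j<b) (H1R j j<b) (H2R j j<b)

  loadL loadR : ℕ → ℕ → ℕ
  loadL φ i = load b (before b phR) (phL i) φ
  loadR φ j = load a (before a phL) (phR j) φ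

  chips : ℕ → ℕ → ℕ
  chips φ x = if x <ᵇ a then loadL φ x else loadR φ (x ∸ a)

  degree : ℕ → ℕ
  degree x = if x <ᵇ a then b else a

  σ : ℕ → Position (a + b)
  σ φ v = chips φ (toℕ v)

  chips-left : ∀ φ {i} → i < a → chips φ i ≡ loadL φ i
  chips-left φ i<a rewrite <ᵇ-true i<a = refl

  chips-right : ∀ φ j → chips φ (a + j) ≡ loadR φ j
  chips-right φ j rewrite <ᵇ-false (m≤m+n a j) | m+n∸m≡n a j = refl

  firesAt : ℕ → ℕ → Bool
  firesAt φ x = degree x ≤ᵇ chips φ x

  next : ℕ → ℕ → ℕ
  next φ x = afterFiring (degree x) (chips φ x)
           + (if x <ᵇ a then count b (λ j → firesAt φ (a + j)) else count a (firesAt φ))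

  U-σ : ∀ φ v → U (K a b) (σ φ) v ≡ next φ (toℕ v)
  U-σ φ v = cong₂ _+_
    (cong (λ D → afterFiring D (σ φ v)) (deg-K a b v))
    (trans (sumFin-cong (a + b) incoming) (neighbourSum a b (toℕ v <ᵇ a) (λ y → ind (firesAt φ y))))
    where
    ind-∧ : ∀ B C → ind (B ∧ C) ≡ (if B then ind C else 0)
    ind-∧ true C = refl
    ind-∧ false C = refl
    incoming : ∀ u → ind (K a b u v ∧ fires (K a b) (σ φ) u)
                     ≡ (if K a b u v then ind (firesAt φ (toℕ u)) else 0)
    incoming u = trans (ind-∧ (K a b u v) _)
      (cong (λ D → if K a b u v then ind (D ≤ᵇ σ φ u) else 0) (deg-K a b u))

  firesAt-right : ∀ φ → φ < P → ∀ {j} → j < b → firesAt φ (a + j) ≡ (phR j ≡ᵇ φ)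
  firesAt-right φ φ<P {j} j<b rewrite <ᵇ-false (m≤m+n a j) | m+n∸m≡n a j = Right.fires-iff j<b φ φ<P

  firesAt-left : ∀ φ → φ < P → ∀ {i} → i < a → firesAt φ i ≡ (phL i ≡ᵇ φ)
  firesAt-left φ φ<P i<a rewrite <ᵇ-true i<a = Left.fires-iff i<a φ φ<P

  step-left : ∀ φ → φ < P → ∀ {i} → i < a → next φ i ≡ chips (suc φ % P) i
  step-left φ φ<P {i} i<a = begin
    next φ i
      ≡⟨ next-left ⟩
    afterFiring b (loadL φ i) + count b (λ j → firesAt φ (a + j))
      ≡⟨ cong (afterFiring b (loadL φ i) +_) (count-cong b (λ j j<b → firesAt-right φ φ<P j<b)) ⟩
    afterFiring b (loadL φ i) + count b (λ j → phR j ≡ᵇ φ)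
      ≡⟨ cong (afterFiring b (loadL φ i) +_) (sym (before-suc b phR φ)) ⟩
    afterFiring b (loadL φ i) + (before b phR (suc φ) ∸ before b phR φ)
      ≡⟨ Left.step i<a φ φ<P ⟩
    loadL (suc φ % P) i
      ≡⟨ sym (chips-left (suc φ % P) i<a) ⟩
    chips (suc φ % P) i ∎
    where
    open ≡-Reasoning
    next-left : next φ i ≡ afterFiring b (loadL φ i) + count b (λ j → firesAt φ (a + j))
    next-left rewrite <ᵇ-true i<a = refl

  step-right : ∀ φ → φ < P → ∀ {j} → j < b → next φ (a + j) ≡ chips (suc φ % P) (a + j)
  step-right φ φ<P {j} j<b = begin
    next φ (a + j)
      ≡⟨ next-right ⟩
    afterFiring a (loadR φ j) + count a (firesAt φ)
      ≡⟨ cong (afterFiring a (loadR φ j) +_) (count-cong a (λ i i<a → firesAt-left φ φ<P i<a)) ⟩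
    afterFiring a (loadR φ j) + count a (λ i → phL i ≡ᵇ φ)
      ≡⟨ cong (afterFiring a (loadR φ j) +_) (sym (before-suc a phL φ)) ⟩
    afterFiring a (loadR φ j) + (before a phL (suc φ) ∸ before a phL φ)
      ≡⟨ Right.step j<b φ φ<P ⟩
    loadR (suc φ % P) j
      ≡⟨ sym (chips-right (suc φ % P) j) ⟩
    chips (suc φ % P) (a + j) ∎
    where
    open ≡-Reasoning
    next-right : next φ (a + j) ≡ afterFiring a (loadR φ j) + count a (firesAt φ)
    next-right rewrite <ᵇ-false (m≤m+n a j) | m+n∸m≡n a j = refl

  step : ∀ φ → φ < P → ∀ v → U (K a b) (σ φ) v ≡ σ (suc φ % P) v
  step φ φ<P v = trans (U-σ φ v) (bySide (sideOf a b (toℕ<n v)))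
    where
    bySide : ∀ {x} → SideOf a b x → next φ x ≡ chips (suc φ % P) x
    bySide (left i<a) = step-left φ φ<P i<a
    bySide (right j<b) = step-right φ φ<P j<b

  -- With a left vertex of phase 0 the phase-0 position has exact period P:
  -- that vertex holds b chips at phase 0 and fewer at every other phase.
  exact-period : 0 < a → phL 0 ≡ 0 → HasPeriod (K a b) (σ 0) P
  exact-period 0<a phase0 = cycle-period (K a b) P σ (orbit (K a b) P σ step) distinct
    where
    v₀ : Fin (a + b)
    v₀ = fromℕ< (≤-trans 0<a (m≤m+n a b))

    σ-v₀ : ∀ φ → σ φ v₀ ≡ loadL φ 0
    σ-v₀ φ = trans (cong (chips φ) (toℕ-fromℕ< (≤-trans 0<a (m≤m+n a b)))) (chips-left φ 0<a)

    distinct : ∀ q → 0 < q → q < P → ∃ λ v → ¬ σ 0 v ≡ σ q v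
    distinct q 0<q q<P = v₀ , λ σ0≡σq → <-irrefl full (subst (_< b) (sym σ0≡σq) fewer)
      where
      full : σ 0 v₀ ≡ b
      full = trans (σ-v₀ 0) (subst (λ c → loadL c 0 ≡ b) phase0 (Left.load-at-phase 0<a))
      fewer : σ q v₀ < b
      fewer = subst (_< b) (sym (σ-v₀ q)) (Left.load-below-after 0<a (subst (_< q) (sym phase0) 0<q) q<P)

-- Period k = k' + 1: on both sides vertex i has phase min(i, k').  As each
-- side has more than k' vertices, every phase ψ ≤ k' is taken by vertex ψ.
module PeriodK (k' : ℕ) where

  phase : ℕ → ℕ
  phase i = i ⊓ k'

  phase<k : ∀ i → phase i < suc k'
  phase<k i = s≤s (m⊓n≤n i k')

  phase-id : ∀ {ψ} → ψ ≤ k' → phase ψ ≡ ψ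
  phase-id = m≤n⇒m⊓n≡m

  -- (H1): before phase c, neighbour φ fires at phase φ.
  early : ∀ d → suc k' ≤ d → ∀ c → c ≤ k' → ∀ φ → φ < c → before d phase φ < before d phase c
  early d k≤d c c≤k' φ φ<c =
    before-strict d phase φ (≤-trans (s≤s φ≤k') k≤d) (≤-reflexive (sym (phase-id φ≤k'))) (subst (_< c) (sym (phase-id φ≤k')) φ<c)
    where
    φ≤k' : φ ≤ k'
    φ≤k' = ≤-trans (<⇒≤ φ<c) c≤k'

  -- (H2): neighbour k' fires only at the last phase k'.
  late : ∀ d → suc k' ≤ d → ∀ c φ → φ < suc k' → before d phase φ ∸ before d phase c < d
  late d k≤d c φ φ<k = ≤-<-trans (m∸n≤m (before d phase φ) (before d phase c))
    (before-<-all d phase (suc k') (λ i _ → phase<k i) k' k≤d (subst (φ ≤_) (sym (phase-id ≤-refl)) (m<1+n⇒m≤n φ<k)))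

  module Position (a b : ℕ) (k≤a : suc k' ≤ a) (k≤b : suc k' ≤ b) =
    PhasePosition a b (suc k') phase phase (λ i _ → phase<k i) (λ j _ → phase<k j)
      (λ i _ → early b k≤b (phase i) (m⊓n≤n i k')) (λ i _ φ _ → late b k≤b (phase i) φ)
      (λ j _ → early a k≤a (phase j) (m⊓n≤n j k')) (λ j _ φ _ → late a k≤a (phase j) φ)

-- Period 2k = 2(k' + 1): left vertex i has the even phase 2·min(i, k'), right
-- vertex a + j the odd phase 2·min(j, k') + 1, so the two sides fire alternately.
module Period2K (k' : ℕ) where

  even odd : ℕ → ℕ
  even i = 2 * (i ⊓ k')
  odd j = suc (2 * (j ⊓ k'))

  even-id : ∀ {x} → x ≤ k' → even x ≡ 2 * x
  even-id x≤k' = cong (2 *_) (m≤n⇒m⊓n≡m x≤k')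

  odd-id : ∀ {x} → x ≤ k' → odd x ≡ suc (2 * x)
  odd-id x≤k' = cong suc (even-id x≤k')

  odd-bound : ∀ {x} → x ≤ k' → suc (2 * x) < 2 * suc k'
  odd-bound {x} x≤k' = subst (suc (2 * x) <_) (sym (*-suc 2 k')) (s≤s (s≤s (*-monoʳ-≤ 2 x≤k')))

  even<P : ∀ i → even i < 2 * suc k'
  even<P i = <-trans (n<1+n _) (odd-bound (m⊓n≤n i k'))

  odd<P : ∀ j → odd j < 2 * suc k'
  odd<P j = odd-bound (m⊓n≤n j k')

  -- (H1) on the left: before phase 2x, right neighbour x - 1 fires at 2x - 1.
  left-early : ∀ b → suc k' ≤ b → ∀ x → x ≤ k' → ∀ φ → φ < 2 * x → before b odd φ < before b odd (2 * x)
  left-early b k≤b (suc x) 1+x≤k' φ φ<2+2x = before-strict b odd x (≤-trans (s≤s x≤k') k≤b) φ≤odd odd<2+2x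
    where
    x≤k' : x ≤ k'
    x≤k' = ≤-trans (n≤1+n x) 1+x≤k'
    φ≤odd : φ ≤ odd x
    φ≤odd = subst (φ ≤_) (sym (odd-id x≤k')) (m<1+n⇒m≤n (subst (φ <_) (*-suc 2 x) φ<2+2x))
    odd<2+2x : odd x < 2 * suc x
    odd<2+2x = subst₂ _<_ (sym (odd-id x≤k')) (sym (*-suc 2 x)) ≤-refl

  -- (H2) on the left: right neighbour k' fires only at the last phase 2k' + 1.
  left-late : ∀ b → suc k' ≤ b → ∀ c φ → φ < 2 * suc k' → before b odd φ ∸ before b odd c < b
  left-late b k≤b c φ φ<P = ≤-<-trans (m∸n≤m (before b odd φ) (before b odd c)) (before-<-all b odd (2 * suc k') (λ j _ → odd<P j) k' k≤b φ≤odd)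
    where
    φ≤odd : φ ≤ odd k'
    φ≤odd = subst (φ ≤_) (sym (odd-id ≤-refl)) (m<1+n⇒m≤n (subst (φ <_) (*-suc 2 k') φ<P))

  -- (H1) on the right: before phase 2x + 1, left neighbour x fires at 2x.
  right-early : ∀ a → suc k' ≤ a → ∀ x → x ≤ k' → ∀ φ → φ < suc (2 * x) →
    before a even φ < before a even (suc (2 * x))
  right-early a k≤a x x≤k' φ φ<1+2x = before-strict a even x (≤-trans (s≤s x≤k') k≤a)
    (subst (φ ≤_) (sym (even-id x≤k')) (m<1+n⇒m≤n φ<1+2x)) (subst (_< suc (2 * x)) (sym (even-id x≤k')) ≤-refl)

  -- (H2) on the right: left neighbour 0 has already fired at phase 0, so at
  -- most a - 1 chips arrive after an odd phase.
  right-late : ∀ a → suc k' ≤ a → ∀ c φ → before a even φ ∸ before a even (suc c) < a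
  right-late a k≤a c φ = ∸-<-bound (count-≤ a (λ i → even i <ᵇ φ)) fired (≤-trans (s≤s z≤n) k≤a)
    where
    fired : 0 < before a even (suc c)
    fired = subst (_< before a even (suc c)) (before-zero a even) (before-strict a even 0 (≤-trans (s≤s z≤n) k≤a) z≤n (s≤s z≤n))

  module Position (a b : ℕ) (k≤a : suc k' ≤ a) (k≤b : suc k' ≤ b) =
    PhasePosition a b (2 * suc k') even odd (λ i _ → even<P i) (λ j _ → odd<P j)
      (λ i _ → left-early b k≤b (i ⊓ k') (m⊓n≤n i k')) (λ i _ φ _ → left-late b k≤b (even i) φ)
      (λ j _ → right-early a k≤a (j ⊓ k') (m⊓n≤n j k')) (λ j _ φ _ _ → right-late a k≤a (2 * (j ⊓ k')) φ)

-- For 1 ≤ k ≤ min(a, b) both phase assignments apply; vertex 0 has phase 0.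
proposition3p7 : (a b : ℕ) → 1 ≤ a → 1 ≤ b → (k : ℕ) → 1 ≤ k → k ≤ a ⊓ b →
    (∃ λ (σ : Position (a + b)) → HasPeriod (K a b) σ k) ×
    (∃ λ (σ′ : Position (a + b)) → HasPeriod (K a b) σ′ (2 * k))
proposition3p7 a b 0<a _ (suc k') _ k≤a⊓b =
  (PeriodK-on-Kab.σ 0 , PeriodK-on-Kab.exact-period 0<a refl) ,
  (Period2K-on-Kab.σ 0 , Period2K-on-Kab.exact-period 0<a refl)
  where
  k≤a : suc k' ≤ a
  k≤a = ≤-trans k≤a⊓b (m⊓n≤m a b)
  k≤b : suc k' ≤ b
  k≤b = ≤-trans k≤a⊓b (m⊓n≤n a b)
  module PeriodK-on-Kab = PeriodK.Position k' a b k≤a k≤b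
  module Period2K-on-Kab = Period2K.Position k' a b k≤a k≤b
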